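{- Let $\mathcal{D}$ be a class of bipartite degree sequences containing some $\alpha$ whose first colour class is nonempty and some $\beta$ whose second colour class is nonempty. Then $\overline{\mathcal{D}^\circ}$, the closure of $\mathcal{D}$ under the composition operator $\circ$, is not $P$-stable.
   Context: A (splitted) bipartite graph $G[A,B]$ has ordered colour classes $A$ (first) and $B$ (second), all edges between $A$ and $B$. A bipartite degree sequence $\bm d=(\bm d^A;\bm d^B)$ is the degree sequence of some such graph, split along the bipartition; $\mathcal{G}(\bm d)$ is its set of labelled realizations. For splitted bipartite graphs $G[A,B]$ and $H[C,D]$ on disjoint vertex sets, their composition is $G[A,B]\circ H[C,D]:=G[A,B]\cup H[C,D]+\{ad: a\in A, d\in D\}$, a splitted bipartite graph with colour classes $A\cup C$ and $B\cup D$. The composition $\alpha\circ\beta$ of bipartite degree sequences (on disjoint vertex sets) is the degree sequence of the composition of a realization of $\alpha$ with a realization of $\beta$ (explicitly: vertices of the first class of $\alpha$ gain $|D|$, vertices of the second class of $\beta$ gain $|A|$, others unchanged). $\overline{\mathcal{D}^\circ}$ is the smallest class containing $\mathcal{D}$ and closed under $\circ$ (composing copies on disjoint vertex sets). A set $\mathcal{D}'$ of bipartite degree sequences is $P$-stable if there is a polynomial $p$ such that for every $\bm d\in\mathcal{D}'$ on $N$ vertices and every $\bm d':\operatorname{Dom}(\bm d)\to\mathbb{N}$ with $\|\bm d'-\bm d\|_1\le 2$ we have $|\mathcal{G}(\bm d')|\le p(N)\,|\mathcal{G}(\bm d)|$. -}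

module Defs where

open import Data.Nat using (ℕ; zero; suc; _+_; _*_; _^_; _≤_; ∣_-_∣)
open import Data.Fin using (Fin; splitAt)
open import Data.Bool using (Bool; true; false; if_then_else_)
open import Data.Vec using (Vec; []; _∷_; lookup)
open import Data.List using (List; []; _∷_; [_]; map; concatMap; filter; length)
open import Data.Product using (_×_; ∃; Σ)
open import Data.Sum using ([_,_])
open import Data.Nat.Properties using (_≟_)
open import Data.Fin.Properties using (all?)
open import Relation.Nullary using (Dec)
open import Relation.Nullary.Decidable using (_×-dec_)
open import Relation.Binary.PropositionalEquality using (_≡_)

sumFin : (n : ℕ) → (Fin n → ℕ) → ℕ
sumFin zero    f = 0
sumFin (suc n) f = f Fin.zero + sumFin n (λ i → f (Fin.suc i))

-- A splitted bipartite (candidate) degree sequence: the first colour class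
-- is Fin m, the second is Fin n, with degree functions dA, dB.
record BSeq : Set where
  constructor bseq
  field
    m  : ℕ
    n  : ℕ
    dA : Fin m → ℕ
    dB : Fin n → ℕ
open BSeq public

size : BSeq → ℕ
size d = m d + n d

-- A labelled splitted bipartite graph G[A,B] with A = Fin m, B = Fin n:
-- the biadjacency matrix (row a, column b is true iff ab is an edge).
Graph : ℕ → ℕ → Set
Graph m n = Vec (Vec Bool n) m

b2n : Bool → ℕ
b2n b = if b then 1 else 0

degA : ∀ {m n} → Graph m n → Fin m → ℕ
degA {m} {n} G a = sumFin n (λ b → b2n (lookup (lookup G a) b))

degB : ∀ {m n} → Graph m n → Fin n → ℕ
degB {m} {n} G b = sumFin m (λ a → b2n (lookup (lookup G a) b))

Realizes : (d : BSeq) → Graph (m d) (n d) → Set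
Realizes d G = (∀ a → degA G a ≡ dA d a) × (∀ b → degB G b ≡ dB d b)

realizes? : (d : BSeq) → (G : Graph (m d) (n d)) → Dec (Realizes d G)
realizes? d G = all? (λ a → degA G a ≟ dA d a) ×-dec all? (λ b → degB G b ≟ dB d b)

IsBDS : BSeq → Set
IsBDS d = ∃ λ (G : Graph (m d) (n d)) → Realizes d G

allVecs : ∀ {A : Set} → List A → (k : ℕ) → List (Vec A k)
allVecs xs zero    = [ [] ]
allVecs xs (suc k) = concatMap (λ v → map (λ x → x ∷ v) xs) (allVecs xs k)

allGraphs : (m n : ℕ) → List (Graph m n)
allGraphs m n = allVecs (allVecs (true ∷ false ∷ []) n) m

numReal : BSeq → ℕ
numReal d = length (filter (realizes? d) (allGraphs (m d) (n d)))

-- Composition of splitted degree sequences: first class Fin (m₁ + m₂)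
-- (A then C), second class Fin (n₁ + n₂) (B then D).
-- Vertices of A gain |D| = n₂, vertices of D gain |A| = m₁.
_∘ᵇ_ : BSeq → BSeq → BSeq
bseq m₁ n₁ a₁ b₁ ∘ᵇ bseq m₂ n₂ a₂ b₂ =
  bseq (m₁ + m₂) (n₁ + n₂)
       (λ i → [ (λ x → a₁ x + n₂) , a₂ ] (splitAt m₁ i))
       (λ j → [ b₁ , (λ y → b₂ y + m₁) ] (splitAt n₁ j))

data Closure (𝒟 : BSeq → Set) : BSeq → Set where
  base : ∀ {d} → 𝒟 d → Closure 𝒟 d
  comp : ∀ {d e} → Closure 𝒟 d → Closure 𝒟 e → Closure 𝒟 (d ∘ᵇ e)

dist₁ : (d : BSeq) → (Fin (m d) → ℕ) → (Fin (n d) → ℕ) → ℕ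
dist₁ d a' b' = sumFin (m d) (λ i → ∣ a' i - dA d i ∣)
              + sumFin (n d) (λ j → ∣ b' j - dB d j ∣)

-- polynomials with natural-number coefficients (constant term first)
Poly : Set
Poly = List ℕ

evalP : Poly → ℕ → ℕ
evalP []       x = 0
evalP (c ∷ cs) x = c + x * evalP cs x

PStable : (BSeq → Set) → Set
PStable 𝒟' = Σ Poly λ p → ∀ d → 𝒟' d →
  (a' : Fin (m d) → ℕ) (b' : Fin (n d) → ℕ) → dist₁ d a' b' ≤ 2 →
  numReal (bseq (m d) (n d) a' b') ≤ evalP p (size d) * numReal d

-- Compose repeatedly: z₀ = α ∘ β and z_{k+1} = z_k ∘ z_k, marking a vertex a in the first
-- class (coming from α) and a vertex d in the second class (coming from β). If x is balanced,
-- every realization of x ∘ y contains all edges between the first class of x and the second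
-- class of y and none between the other two classes, so |G(x ∘ y)| ≤ |G(x)| |G(y)|.
-- Lowering the degrees of the marked a and d by one admits the realizations of x ∘ y without
-- the edge ad, and also those built from realizations of x and y lowered at marked vertices,
-- completed by one edge between the other two classes. Hence the ratio of the number of
-- realizations of the lowered z_k to that of z_k is at least t_k, with t_{k+1} = 1 + t_k².
-- P-stability would bound this ratio by p(|z_k|) = p(2^k |z₀|), which grows only
-- geometrically in k.

module Submission where

open import Defs
import Algebra.Properties.CommutativeMonoid.Sum as CommutativeMonoidSum
open import Data.Bool using (Bool; true; false; not; _∧_)
open import Data.Bool.Properties using (∧-comm; not-injective)
open import Data.Empty using (⊥-elim)
open import Data.Fin using (Fin; zero; suc; _↑ˡ_; _↑ʳ_; splitAt; fromℕ<)
open import Data.Fin.Properties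
  using (_≟_; splitAt-↑ˡ; splitAt-↑ʳ; splitAt⁻¹-↑ˡ; splitAt⁻¹-↑ʳ; ↑ˡ-injective; ↑ʳ-injective; nonZeroIndex)
open import Data.List using (List; []; _∷_; length; map; filter; _++_; cartesianProduct)
open import Data.List.Membership.Propositional using (_∈_)
open import Data.List.Membership.Propositional.Properties
  using (∈-filter⁺; ∈-filter⁻; ∈-map⁺; ∈-map⁻; ∈-++⁻; ∈-concatMap⁺; ∈-cartesianProduct⁺; ∈-cartesianProduct⁻)
open import Data.List.Properties using (length-map; length-++; length-removeAt′)
open import Data.List.Relation.Binary.Disjoint.Propositional using (Disjoint)
open import Data.List.Relation.Unary.All as All using ([]; _∷_)
import Data.List.Relation.Unary.All.Properties as Allₚ
open import Data.List.Relation.Unary.AllPairs as AllPairs using ([]; _∷_)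
import Data.List.Relation.Unary.AllPairs.Properties as AllPairsₚ
open import Data.List.Relation.Unary.Any as Any using (here; there; _─_)
open import Data.List.Relation.Unary.Unique.Propositional using (Unique)
import Data.List.Relation.Unary.Unique.Propositional.Properties as Unique
open import Data.Nat
  using (ℕ; zero; suc; NonZero; _+_; _*_; _∸_; _^_; _≤_; _<_; _≥_; z≤n; s≤s; z<s; ∣_-_∣; >-nonZero; >-nonZero⁻¹)
open import Data.Nat.Properties hiding (_≟_)
open import Data.Nat.Tactic.RingSolver using (solve-∀)
open import Data.Product using (_×_; _,_; proj₁; proj₂)
open import Data.Sum using (_⊎_; inj₁; inj₂; [_,_])
open import Data.Vec using (Vec; []; _∷_; lookup; tabulate)
open import Data.Vec.Properties using (∷-injectiveˡ; lookup∘tabulate; tabulate∘lookup; tabulate-cong)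
open import Function using (_∘_; flip; id)
open import Function.Definitions using (Injective)
open import Relation.Binary.PropositionalEquality hiding ([_])
open import Relation.Nullary using (¬_; does; yes; no)

module ℕ-Sum = CommutativeMonoidSum +-0-commutativeMonoid

sumFin≡sum : ∀ n (f : Fin n → ℕ) → sumFin n f ≡ ℕ-Sum.sum f
sumFin≡sum zero    f = refl
sumFin≡sum (suc n) f = cong (f zero +_) (sumFin≡sum n (f ∘ suc))

sumFin-cong : ∀ n {f g : Fin n → ℕ} → f ≗ g → sumFin n f ≡ sumFin n g
sumFin-cong zero    f≗g = refl
sumFin-cong (suc n) f≗g = cong₂ _+_ (f≗g zero) (sumFin-cong n (f≗g ∘ suc))

sumFin-+ : ∀ n (f g : Fin n → ℕ) → sumFin n (λ i → f i + g i) ≡ sumFin n f + sumFin n g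
sumFin-+ n f g = begin
  sumFin n (λ i → f i + g i)  ≡⟨ sumFin≡sum n _ ⟩
  ℕ-Sum.sum (λ i → f i + g i) ≡⟨ ℕ-Sum.∑-distrib-+ f g ⟩
  ℕ-Sum.sum f + ℕ-Sum.sum g   ≡⟨ cong₂ _+_ (sumFin≡sum n f) (sumFin≡sum n g) ⟨
  sumFin n f + sumFin n g     ∎
  where open ≡-Reasoning

sumFin-comm : ∀ m n (h : Fin m → Fin n → ℕ) →
  sumFin m (λ i → sumFin n (h i)) ≡ sumFin n (λ j → sumFin m (λ i → h i j))
sumFin-comm m n h = begin
  sumFin m (λ i → sumFin n (h i))           ≡⟨ sumFin²≡sum² m n h ⟩
  ℕ-Sum.sum (λ i → ℕ-Sum.sum (h i))         ≡⟨ ℕ-Sum.∑-comm h ⟩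
  ℕ-Sum.sum (λ j → ℕ-Sum.sum (λ i → h i j)) ≡⟨ sumFin²≡sum² n m (flip h) ⟨
  sumFin n (λ j → sumFin m (λ i → h i j))   ∎
  where
  open ≡-Reasoning
  sumFin²≡sum² : ∀ m n (h : Fin m → Fin n → ℕ) →
    sumFin m (λ i → sumFin n (h i)) ≡ ℕ-Sum.sum (λ i → ℕ-Sum.sum (h i))
  sumFin²≡sum² m n h = trans (sumFin-cong m (λ i → sumFin≡sum n (h i))) (sumFin≡sum m _)

sumFin-const : ∀ n c → sumFin n (λ _ → c) ≡ n * c
sumFin-const zero    c = refl
sumFin-const (suc n) c = cong (c +_) (sumFin-const n c)

sumFin-mono : ∀ n {f g : Fin n → ℕ} → (∀ i → f i ≤ g i) → sumFin n f ≤ sumFin n g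
sumFin-mono zero    f≤g = z≤n
sumFin-mono (suc n) f≤g = +-mono-≤ (f≤g zero) (sumFin-mono n (f≤g ∘ suc))

sumFin-↑ : ∀ n₁ n₂ (f : Fin (n₁ + n₂) → ℕ) →
  sumFin (n₁ + n₂) f ≡ sumFin n₁ (λ i → f (i ↑ˡ n₂)) + sumFin n₂ (λ j → f (n₁ ↑ʳ j))
sumFin-↑ zero     n₂ f = refl
sumFin-↑ (suc n₁) n₂ f =
  trans (cong (f zero +_) (sumFin-↑ n₁ n₂ (f ∘ suc))) (sym (+-assoc (f zero) _ _))

sumFin-≡-≤⇒≗ : ∀ n {f g : Fin n → ℕ} → (∀ i → f i ≤ g i) → sumFin n f ≡ sumFin n g → f ≗ g
sumFin-≡-≤⇒≗ (suc n) {f} {g} f≤g Σf≡Σg zero    = head≡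
  where
  head≡ : f zero ≡ g zero
  head≡ = ≤-antisym (f≤g zero) (+-cancelʳ-≤ _ (g zero) (f zero)
    (≤-trans (≤-reflexive (sym Σf≡Σg)) (+-monoʳ-≤ (f zero) (sumFin-mono n (f≤g ∘ suc)))))
sumFin-≡-≤⇒≗ (suc n) {f} {g} f≤g Σf≡Σg (suc i) =
  sumFin-≡-≤⇒≗ n (f≤g ∘ suc) (+-cancelˡ-≡ (f zero) _ _
    (trans Σf≡Σg (cong (_+ _) (sym (sumFin-≡-≤⇒≗ (suc n) f≤g Σf≡Σg zero))))) i

sumFin≡0⇒≗0 : ∀ n {f : Fin n → ℕ} → sumFin n f ≡ 0 → ∀ i → f i ≡ 0
sumFin≡0⇒≗0 n Σf≡0 i = sym (sumFin-≡-≤⇒≗ n (λ _ → z≤n)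
  (trans (trans (sumFin-const n 0) (*-zeroʳ n)) (sym Σf≡0)) i)

count : ∀ {k} → (Fin k → Bool) → ℕ
count {k} h = sumFin k (λ i → b2n (h i))

count-cong : ∀ {k} {h h′ : Fin k → Bool} → h ≗ h′ → count h ≡ count h′
count-cong {k} h≗h′ = sumFin-cong k (cong b2n ∘ h≗h′)

count-true : ∀ k → count {k} (λ _ → true) ≡ k
count-true k = trans (sumFin-const k 1) (*-identityʳ k)

count-false : ∀ k → count {k} (λ _ → false) ≡ 0
count-false k = trans (sumFin-const k 0) (*-zeroʳ k)

count≤ : ∀ {k} (h : Fin k → Bool) → count h ≤ k
count≤ {k} h = ≤-trans (sumFin-mono k (λ i → b2n≤1 (h i))) (≤-reflexive (count-true k))
  where
  b2n≤1 : ∀ b → b2n b ≤ 1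
  b2n≤1 true  = s≤s z≤n
  b2n≤1 false = z≤n

count-not : ∀ {k} (h : Fin k → Bool) → count (not ∘ h) ≡ k ∸ count h
count-not {k} h = begin
  count (not ∘ h)                      ≡⟨ m+n∸n≡m _ (count h) ⟨
  count (not ∘ h) + count h ∸ count h  ≡⟨ cong (_∸ count h) count-not+count ⟩
  k ∸ count h                          ∎
  where
  open ≡-Reasoning
  b2n-not+b2n : ∀ b → b2n (not b) + b2n b ≡ 1
  b2n-not+b2n true  = refl
  b2n-not+b2n false = refl
  count-not+count : count (not ∘ h) + count h ≡ k
  count-not+count = trans (sym (sumFin-+ k _ _))
    (trans (sumFin-cong k (b2n-not+b2n ∘ h)) (count-true k))

count≡0⇒false : ∀ {k} (h : Fin k → Bool) → count h ≡ 0 → ∀ i → h i ≡ false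
count≡0⇒false {k} h count≡0 i = b2n≡0⇒false (sumFin≡0⇒≗0 k count≡0 i)
  where
  b2n≡0⇒false : ∀ {b} → b2n b ≡ 0 → b ≡ false
  b2n≡0⇒false {false} _ = refl

count≡k⇒true : ∀ {k} (h : Fin k → Bool) → count h ≡ k → ∀ i → h i ≡ true
count≡k⇒true {k} h count≡k i = not-injective
  (count≡0⇒false (not ∘ h) (trans (count-not h) (trans (cong (k ∸_) count≡k) (n∸n≡0 k))) i)

δ : ∀ {k} → Fin k → Fin k → Bool
δ i j = does (i ≟ j)

δ-refl : ∀ {k} (i : Fin k) → δ i i ≡ true
δ-refl i with i ≟ i
... | yes _   = refl
... | no  i≢i = ⊥-elim (i≢i refl)

δ-≢ : ∀ {k} {i j : Fin k} → i ≢ j → δ i j ≡ false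
δ-≢ {i = i} {j} i≢j with i ≟ j
... | yes i≡j = ⊥-elim (i≢j i≡j)
... | no  _   = refl

δ-injective : ∀ {k l} {f : Fin k → Fin l} → Injective _≡_ _≡_ f → ∀ i j → δ (f i) (f j) ≡ δ i j
δ-injective {f = f} f-inj i j with i ≟ j | f i ≟ f j
... | yes _   | yes _     = refl
... | no  _   | no  _     = refl
... | yes i≡j | no fi≢fj  = ⊥-elim (fi≢fj (cong f i≡j))
... | no  i≢j | yes fi≡fj = ⊥-elim (i≢j (f-inj fi≡fj))

δ≤ : ∀ {k} (f : Fin k → ℕ) i → 1 ≤ f i → ∀ j → b2n (δ i j) ≤ f j
δ≤ f i 1≤fi j with i ≟ j
... | yes refl = 1≤fi
... | no  _    = z≤n

count-δ : ∀ {k} (i : Fin k) → count (δ i) ≡ 1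
count-δ {suc k} zero    = cong suc (count-false k)
count-δ {suc k} (suc i) = count-δ i

count-∧δ : ∀ {k} s (i : Fin k) → count (λ j → s ∧ δ i j) ≡ b2n s
count-∧δ true  i = count-δ i
count-∧δ {k} false i = count-false k

point : ∀ {k l} → Fin k → Fin l → Fin k → Fin l → Bool
point a b a′ b′ = δ a a′ ∧ δ b b′

count-point-row : ∀ {k l} (a : Fin k) (b : Fin l) a′ → count (point a b a′) ≡ b2n (δ a a′)
count-point-row a b a′ = count-∧δ (δ a a′) b

count-point-col : ∀ {k l} (a : Fin k) (b : Fin l) b′ → count (λ a′ → point a b a′ b′) ≡ b2n (δ b b′)
count-point-col a b b′ = trans (count-cong (λ a′ → ∧-comm (δ a a′) (δ b b′))) (count-∧δ (δ b b′) a)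

∈-─⁺ : ∀ {A : Set} {x y : A} {ys : List A} (x∈ys : x ∈ ys) → y ∈ ys → y ≢ x → y ∈ (ys ─ x∈ys)
∈-─⁺ (here refl) (here refl) y≢x = ⊥-elim (y≢x refl)
∈-─⁺ (here _)    (there y∈ys) _   = y∈ys
∈-─⁺ (there _)   (here y≡z)   _   = here y≡z
∈-─⁺ (there x∈ys) (there y∈ys) y≢x = there (∈-─⁺ x∈ys y∈ys y≢x)

injection⇒length≤ : ∀ {A B : Set} {xs : List A} {ys : List B} (f : A → B) → Unique xs →
  (∀ {x} → x ∈ xs → f x ∈ ys) →
  (∀ {x x′} → x ∈ xs → x′ ∈ xs → f x ≡ f x′ → x ≡ x′) →
  length xs ≤ length ys
injection⇒length≤ {xs = []}     f _ _ _ = z≤n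
injection⇒length≤ {xs = x ∷ xs} {ys} f (x∉xs ∷ xs!) maps-into injective =
  subst (suc (length xs) ≤_) (sym (length-removeAt′ ys _)) (s≤s (injection⇒length≤ f xs!
    (λ x′∈xs → ∈-─⁺ fx∈ys (maps-into (there x′∈xs))
      (λ fx′≡fx → All.lookup x∉xs x′∈xs (injective (here refl) (there x′∈xs) (sym fx′≡fx))))
    (λ x′∈xs x″∈xs → injective (there x′∈xs) (there x″∈xs))))
  where
  fx∈ys = maps-into (here refl)

unique⊆⇒length≤ : ∀ {A : Set} {xs ys : List A} → Unique xs → (∀ {x} → x ∈ xs → x ∈ ys) →
  length xs ≤ length ys
unique⊆⇒length≤ xs! xs⊆ys = injection⇒length≤ id xs! xs⊆ys (λ _ _ x≡x′ → x≡x′)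

length-cartesianProduct : ∀ {A B : Set} (xs : List A) (ys : List B) →
  length (cartesianProduct xs ys) ≡ length xs * length ys
length-cartesianProduct []       ys = refl
length-cartesianProduct (x ∷ xs) ys = trans (length-++ (map (x ,_) ys))
  (cong₂ _+_ (length-map (x ,_) ys) (length-cartesianProduct xs ys))

allVecs-unique : ∀ {A : Set} {xs : List A} → Unique xs → ∀ k → Unique (allVecs xs k)
allVecs-unique xs! zero    = [] ∷ []
allVecs-unique {xs = xs} xs! (suc k) =
  Unique.concat⁺ (Allₚ.map⁺ (All.universal (λ _ → Unique.map⁺ ∷-injectiveˡ xs!) _))
    (AllPairsₚ.map⁺ (AllPairs.map row-disjoint (allVecs-unique xs! k)))
  where
  row : ∀ {k} → Vec _ k → List (Vec _ (suc k))
  row v = map (_∷ v) xs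
  row-disjoint : ∀ {k} {v w : Vec _ k} → v ≢ w → Disjoint (row v) (row w)
  row-disjoint v≢w (p , q) with ∈-map⁻ (_∷ _) p | ∈-map⁻ (_∷ _) q
  ... | _ , _ , refl | _ , _ , refl = v≢w refl

∈-allVecs : ∀ {A : Set} {xs : List A} → (∀ x → x ∈ xs) → ∀ {k} (v : Vec A k) → v ∈ allVecs xs k
∈-allVecs x∈xs []      = here refl
∈-allVecs {xs = xs} x∈xs (x ∷ v) =
  ∈-concatMap⁺ (λ w → map (_∷ w) xs) (Any.map (λ { refl → ∈-map⁺ (_∷ _) (x∈xs x) }) (∈-allVecs x∈xs v))

allGraphs-unique : ∀ m n → Unique (allGraphs m n)
allGraphs-unique m n = allVecs-unique (allVecs-unique (((λ ()) ∷ []) ∷ [] ∷ []) n) m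

∈-allGraphs : ∀ {m n} (G : Graph m n) → G ∈ allGraphs m n
∈-allGraphs = ∈-allVecs (∈-allVecs λ { true → here refl ; false → there (here refl) })

realizations : (d : BSeq) → List (Graph (m d) (n d))
realizations d = filter (realizes? d) (allGraphs (m d) (n d))

realizations-unique : ∀ d → Unique (realizations d)
realizations-unique d = Unique.filter⁺ (realizes? d) (allGraphs-unique (m d) (n d))

∈-realizations⁺ : ∀ d {G} → Realizes d G → G ∈ realizations d
∈-realizations⁺ d {G} G⊨d = ∈-filter⁺ (realizes? d) {x = G} (∈-allGraphs G) G⊨d

∈-realizations⁻ : ∀ d {G} → G ∈ realizations d → Realizes d G
∈-realizations⁻ d {G} G∈ = proj₂ (∈-filter⁻ (realizes? d) {v = G} {xs = allGraphs (m d) (n d)} G∈)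

numReal-pos : ∀ d → IsBDS d → 0 < numReal d
numReal-pos d (G , G⊨d) with realizations d | ∈-realizations⁺ d {G} G⊨d
... | _ ∷ _ | _ = z<s

map-pairs-unique : ∀ {x y} {B : Set} (f : Graph (m x) (n x) × Graph (m y) (n y) → B) → Injective _≡_ _≡_ f →
  Unique (map f (cartesianProduct (realizations x) (realizations y)))
map-pairs-unique {x} {y} f f-injective =
  Unique.map⁺ f-injective (Unique.cartesianProduct⁺ (realizations-unique x) (realizations-unique y))

length-map-pairs : ∀ {x y} {B : Set} (f : Graph (m x) (n x) × Graph (m y) (n y) → B) →
  length (map f (cartesianProduct (realizations x) (realizations y))) ≡ numReal x * numReal y
length-map-pairs {x} {y} f = trans (length-map f (cartesianProduct (realizations x) (realizations y)))
  (length-cartesianProduct (realizations x) (realizations y))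

pairs⊆realizations : ∀ {x y z} (f : Graph (m x) (n x) × Graph (m y) (n y) → Graph (m z) (n z)) →
  (∀ Gx Gy → Realizes x Gx → Realizes y Gy → Realizes z (f (Gx , Gy))) →
  ∀ {G} → G ∈ map f (cartesianProduct (realizations x) (realizations y)) → G ∈ realizations z
pairs⊆realizations {x} {y} {z} f f-realizes G∈ with ∈-map⁻ f G∈
... | (Gx , Gy) , p∈ , refl with ∈-cartesianProduct⁻ (realizations x) (realizations y) p∈
... | Gx∈ , Gy∈ = ∈-realizations⁺ z (f-realizes Gx Gy (∈-realizations⁻ x Gx∈) (∈-realizations⁻ y Gy∈))

entry : ∀ {m n} → Graph m n → Fin m → Fin n → Bool
entry G a b = lookup (lookup G a) b

graph : ∀ {m n} → (Fin m → Fin n → Bool) → Graph m n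
graph f = tabulate (λ a → tabulate (f a))

entry-graph : ∀ {m n} (f : Fin m → Fin n → Bool) a b → entry (graph f) a b ≡ f a b
entry-graph f a b = trans (cong (λ row → lookup row b) (lookup∘tabulate _ a)) (lookup∘tabulate (f a) b)

graph-ext : ∀ {m n} {G G′ : Graph m n} → (∀ a b → entry G a b ≡ entry G′ a b) → G ≡ G′
graph-ext {G = G} {G′} G≐G′ = begin
  G                     ≡⟨ graph-entry G ⟨
  graph (entry G)       ≡⟨ tabulate-cong (λ a → tabulate-cong (G≐G′ a)) ⟩
  graph (entry G′)      ≡⟨ graph-entry G′ ⟩
  G′                    ∎
  where
  open ≡-Reasoning
  graph-entry : ∀ {m n} (G : Graph m n) → graph (entry G) ≡ G
  graph-entry G = trans (tabulate-cong (λ a → tabulate∘lookup (lookup G a))) (tabulate∘lookup G)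

splitAt-elim : ∀ m n (P : Fin (m + n) → Set) → (∀ a → P (a ↑ˡ n)) → (∀ c → P (m ↑ʳ c)) → ∀ i → P i
splitAt-elim m n P P↑ˡ P↑ʳ i with splitAt m i in eq
... | inj₁ a = subst P (splitAt⁻¹-↑ˡ eq) (P↑ˡ a)
... | inj₂ c = subst P (splitAt⁻¹-↑ʳ eq) (P↑ʳ c)

↑ˡ≢↑ʳ : ∀ {m n} (a : Fin m) (c : Fin n) → a ↑ˡ n ≢ m ↑ʳ c
↑ˡ≢↑ʳ {m} {n} a c a≡c with trans (sym (splitAt-↑ˡ m a n)) (trans (cong (splitAt m) a≡c) (splitAt-↑ʳ m n c))
... | ()

module Blocks (m₁ m₂ n₁ n₂ : ℕ) where

  Block : ℕ → ℕ → Set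
  Block k l = Fin k → Fin l → Bool

  module _ (G : Graph (m₁ + m₂) (n₁ + n₂)) where
    AB : Block m₁ n₁
    AB a b = entry G (a ↑ˡ m₂) (b ↑ˡ n₂)
    AD : Block m₁ n₂
    AD a d = entry G (a ↑ˡ m₂) (n₁ ↑ʳ d)
    CB : Block m₂ n₁
    CB c b = entry G (m₁ ↑ʳ c) (b ↑ˡ n₂)
    CD : Block m₂ n₂
    CD c d = entry G (m₁ ↑ʳ c) (n₁ ↑ʳ d)

    degA-↑ˡ : ∀ a → degA G (a ↑ˡ m₂) ≡ count (AB a) + count (AD a)
    degA-↑ˡ a = sumFin-↑ n₁ n₂ _
    degA-↑ʳ : ∀ c → degA G (m₁ ↑ʳ c) ≡ count (CB c) + count (CD c)
    degA-↑ʳ c = sumFin-↑ n₁ n₂ _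
    degB-↑ˡ : ∀ b → degB G (b ↑ˡ n₂) ≡ count (λ a → AB a b) + count (λ c → CB c b)
    degB-↑ˡ b = sumFin-↑ m₁ m₂ _
    degB-↑ʳ : ∀ d → degB G (n₁ ↑ʳ d) ≡ count (λ a → AD a d) + count (λ c → CD c d)
    degB-↑ʳ d = sumFin-↑ m₁ m₂ _

  ≡-byBlocks : ∀ {G G′} →
    (∀ a b → AB G a b ≡ AB G′ a b) → (∀ a d → AD G a d ≡ AD G′ a d) →
    (∀ c b → CB G c b ≡ CB G′ c b) → (∀ c d → CD G c d ≡ CD G′ c d) → G ≡ G′
  ≡-byBlocks {G} {G′} AB≡ AD≡ CB≡ CD≡ = graph-ext λ i j →
    splitAt-elim m₁ m₂ (λ i → entry G i j ≡ entry G′ i j)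
      (λ a → splitAt-elim n₁ n₂ (λ j → entry G (a ↑ˡ m₂) j ≡ entry G′ (a ↑ˡ m₂) j) (AB≡ a) (AD≡ a) j)
      (λ c → splitAt-elim n₁ n₂ (λ j → entry G (m₁ ↑ʳ c) j ≡ entry G′ (m₁ ↑ʳ c) j) (CB≡ c) (CD≡ c) j)
      i

  quadrant : Block m₁ n₁ → Block m₁ n₂ → Block m₂ n₁ → Block m₂ n₂ →
    Fin m₁ ⊎ Fin m₂ → Fin n₁ ⊎ Fin n₂ → Bool
  quadrant ab ad cb cd (inj₁ a) (inj₁ b) = ab a b
  quadrant ab ad cb cd (inj₁ a) (inj₂ d) = ad a d
  quadrant ab ad cb cd (inj₂ c) (inj₁ b) = cb c b
  quadrant ab ad cb cd (inj₂ c) (inj₂ d) = cd c d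

  block : Block m₁ n₁ → Block m₁ n₂ → Block m₂ n₁ → Block m₂ n₂ → Graph (m₁ + m₂) (n₁ + n₂)
  block ab ad cb cd = graph λ i j → quadrant ab ad cb cd (splitAt m₁ i) (splitAt n₁ j)

  module _ (ab : Block m₁ n₁) (ad : Block m₁ n₂) (cb : Block m₂ n₁) (cd : Block m₂ n₂) where
    private
      G = block ab ad cb cd
      Q = quadrant ab ad cb cd
      entry-G : ∀ i j → entry G i j ≡ Q (splitAt m₁ i) (splitAt n₁ j)
      entry-G = entry-graph (λ i j → Q (splitAt m₁ i) (splitAt n₁ j))

    AB-block : ∀ a b → AB G a b ≡ ab a b
    AB-block a b = trans (entry-G _ _) (cong₂ Q (splitAt-↑ˡ m₁ a m₂) (splitAt-↑ˡ n₁ b n₂))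
    AD-block : ∀ a d → AD G a d ≡ ad a d
    AD-block a d = trans (entry-G _ _) (cong₂ Q (splitAt-↑ˡ m₁ a m₂) (splitAt-↑ʳ n₁ n₂ d))
    CB-block : ∀ c b → CB G c b ≡ cb c b
    CB-block c b = trans (entry-G _ _) (cong₂ Q (splitAt-↑ʳ m₁ m₂ c) (splitAt-↑ˡ n₁ b n₂))
    CD-block : ∀ c d → CD G c d ≡ cd c d
    CD-block c d = trans (entry-G _ _) (cong₂ Q (splitAt-↑ʳ m₁ m₂ c) (splitAt-↑ʳ n₁ n₂ d))

    block-realizes : (tA : Fin (m₁ + m₂) → ℕ) (tB : Fin (n₁ + n₂) → ℕ) →
      (∀ a → count (ab a) + count (ad a) ≡ tA (a ↑ˡ m₂)) →
      (∀ c → count (cb c) + count (cd c) ≡ tA (m₁ ↑ʳ c)) →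
      (∀ b → count (λ a → ab a b) + count (λ c → cb c b) ≡ tB (b ↑ˡ n₂)) →
      (∀ d → count (λ a → ad a d) + count (λ c → cd c d) ≡ tB (n₁ ↑ʳ d)) →
      Realizes (bseq (m₁ + m₂) (n₁ + n₂) tA tB) G
    block-realizes tA tB rowA rowC colB colD =
      splitAt-elim m₁ m₂ (λ i → degA G i ≡ tA i)
        (λ a → trans (degA-↑ˡ G a) (trans (cong₂ _+_ (count-cong (AB-block a)) (count-cong (AD-block a))) (rowA a)))
        (λ c → trans (degA-↑ʳ G c) (trans (cong₂ _+_ (count-cong (CB-block c)) (count-cong (CD-block c))) (rowC c))) ,
      splitAt-elim n₁ n₂ (λ j → degB G j ≡ tB j)
        (λ b → trans (degB-↑ˡ G b) (trans (cong₂ _+_ (count-cong (flip AB-block b)) (count-cong (flip CB-block b))) (colB b)))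
        (λ d → trans (degB-↑ʳ G d) (trans (cong₂ _+_ (count-cong (flip AD-block d)) (count-cong (flip CD-block d))) (colD d)))

  assemble : Block m₁ n₂ → Block m₂ n₁ → Graph m₁ n₁ × Graph m₂ n₂ → Graph (m₁ + m₂) (n₁ + n₂)
  assemble ad cb (Gx , Gy) = block (entry Gx) ad cb (entry Gy)

  assemble-injective : ∀ ad cb → Injective _≡_ _≡_ (assemble ad cb)
  assemble-injective ad cb {Gx , Gy} {Gx′ , Gy′} G≡G′ = cong₂ _,_
    (graph-ext λ a b → trans (sym (AB-block _ ad cb _ a b))
      (trans (cong (λ G → AB G a b) G≡G′) (AB-block _ ad cb _ a b)))
    (graph-ext λ c d → trans (sym (CD-block _ ad cb _ c d))
      (trans (cong (λ G → CD G c d) G≡G′) (CD-block _ ad cb _ c d)))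

module _ (x y : BSeq) where

  dA-∘-↑ˡ : ∀ a → dA (x ∘ᵇ y) (a ↑ˡ m y) ≡ dA x a + n y
  dA-∘-↑ˡ a = cong [ (λ a → dA x a + n y) , dA y ] (splitAt-↑ˡ (m x) a (m y))

  dA-∘-↑ʳ : ∀ c → dA (x ∘ᵇ y) (m x ↑ʳ c) ≡ dA y c
  dA-∘-↑ʳ c = cong [ (λ a → dA x a + n y) , dA y ] (splitAt-↑ʳ (m x) (m y) c)

  dB-∘-↑ˡ : ∀ b → dB (x ∘ᵇ y) (b ↑ˡ n y) ≡ dB x b
  dB-∘-↑ˡ b = cong [ dB x , (λ d → dB y d + m x) ] (splitAt-↑ˡ (n x) b (n y))

  dB-∘-↑ʳ : ∀ d → dB (x ∘ᵇ y) (n x ↑ʳ d) ≡ dB y d + m x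
  dB-∘-↑ʳ d = cong [ dB x , (λ d → dB y d + m x) ] (splitAt-↑ʳ (n x) (n y) d)

  open Blocks (m x) (m y) (n x) (n y)

  ∘-graph : Graph (m x) (n x) × Graph (m y) (n y) → Graph (m x + m y) (n x + n y)
  ∘-graph = assemble (λ _ _ → true) (λ _ _ → false)

  ∘-realizes : ∀ Gx Gy → Realizes x Gx → Realizes y Gy → Realizes (x ∘ᵇ y) (∘-graph (Gx , Gy))
  ∘-realizes Gx Gy (Gx⊨A , Gx⊨B) (Gy⊨A , Gy⊨B) =
    block-realizes (entry Gx) (λ _ _ → true) (λ _ _ → false) (entry Gy) (dA (x ∘ᵇ y)) (dB (x ∘ᵇ y))
      (λ a → trans (cong₂ _+_ (Gx⊨A a) (count-true (n y))) (sym (dA-∘-↑ˡ a)))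
      (λ c → trans (cong₂ _+_ (count-false (n x)) (Gy⊨A c)) (sym (dA-∘-↑ʳ c)))
      (λ b → trans (cong₂ _+_ (Gx⊨B b) (count-false (m y))) (trans (+-identityʳ _) (sym (dB-∘-↑ˡ b))))
      (λ d → trans (cong₂ _+_ (count-true (m x)) (Gy⊨B d)) (trans (+-comm (m x) _) (sym (dB-∘-↑ʳ d))))

IsBDS-∘ : ∀ {x y} → IsBDS x → IsBDS y → IsBDS (x ∘ᵇ y)
IsBDS-∘ {x} {y} (Gx , Gx⊨x) (Gy , Gy⊨y) = ∘-graph x y (Gx , Gy) , ∘-realizes x y Gx Gy Gx⊨x Gy⊨y

IsBDS-closure : ∀ {𝒟 : BSeq → Set} → (∀ d → 𝒟 d → IsBDS d) → ∀ {z} → Closure 𝒟 z → IsBDS z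
IsBDS-closure 𝒟⊆BDS (base d∈𝒟) = 𝒟⊆BDS _ d∈𝒟
IsBDS-closure 𝒟⊆BDS (comp d∈ e∈) = IsBDS-∘ (IsBDS-closure 𝒟⊆BDS d∈) (IsBDS-closure 𝒟⊆BDS e∈)

Balanced : BSeq → Set
Balanced x = sumFin (m x) (dA x) ≡ sumFin (n x) (dB x)

IsBDS⇒Balanced : ∀ x → IsBDS x → Balanced x
IsBDS⇒Balanced x (G , G⊨A , G⊨B) = begin
  sumFin (m x) (dA x)                       ≡⟨ sumFin-cong (m x) G⊨A ⟨
  sumFin (m x) (degA G)                     ≡⟨ sumFin-comm (m x) (n x) (λ a b → b2n (entry G a b)) ⟩
  sumFin (n x) (degB G)                     ≡⟨ sumFin-cong (n x) G⊨B ⟩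
  sumFin (n x) (dB x)                       ∎
  where open ≡-Reasoning

module _ (x y : BSeq) where
  open Blocks (m x) (m y) (n x) (n y)
  private
    m₁ = m x
    m₂ = m y
    n₁ = n x
    n₂ = n y

  restriction : Graph (m₁ + m₂) (n₁ + n₂) → Graph m₁ n₁ × Graph m₂ n₂
  restriction G = graph (AB G) , graph (CD G)

  module Forced (x-balanced : Balanced x) (G : Graph (m₁ + m₂) (n₁ + n₂)) (G⊨ : Realizes (x ∘ᵇ y) G) where
    rowA : ∀ a → count (AB G a) + count (AD G a) ≡ dA x a + n₂
    rowA a = trans (sym (degA-↑ˡ G a)) (trans (proj₁ G⊨ (a ↑ˡ m₂)) (dA-∘-↑ˡ x y a))
    rowC : ∀ c → count (CB G c) + count (CD G c) ≡ dA y c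
    rowC c = trans (sym (degA-↑ʳ G c)) (trans (proj₁ G⊨ (m₁ ↑ʳ c)) (dA-∘-↑ʳ x y c))
    colB : ∀ b → count (λ a → AB G a b) + count (λ c → CB G c b) ≡ dB x b
    colB b = trans (sym (degB-↑ˡ G b)) (trans (proj₂ G⊨ (b ↑ˡ n₂)) (dB-∘-↑ˡ x y b))
    colD : ∀ d → count (λ a → AD G a d) + count (λ c → CD G c d) ≡ dB y d + m₁
    colD d = trans (sym (degB-↑ʳ G d)) (trans (proj₂ G⊨ (n₁ ↑ʳ d)) (dB-∘-↑ʳ x y d))

    private
      S T U : ℕ
      S = sumFin m₁ (count ∘ AB G)
      T = sumFin m₁ (count ∘ AD G)
      U = sumFin n₁ (λ b → count (λ c → CB G c b))

    -- Double counting the AB block by rows and by columns: balancedness of x leaves room for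
    -- U + |A| |D| edges in the AD block, which holds at most |A| |D| of them.
    T≡U+m₁n₂ : T ≡ U + m₁ * n₂
    T≡U+m₁n₂ = +-cancelˡ-≡ S _ _ (begin
      S + T                                                   ≡⟨ sumFin-+ m₁ _ _ ⟨
      sumFin m₁ (λ a → count (AB G a) + count (AD G a))       ≡⟨ sumFin-cong m₁ rowA ⟩
      sumFin m₁ (λ a → dA x a + n₂)                           ≡⟨ sumFin-+ m₁ _ _ ⟩
      sumFin m₁ (dA x) + sumFin m₁ (λ _ → n₂)                 ≡⟨ cong₂ _+_ x-balanced (sumFin-const m₁ n₂) ⟩
      sumFin n₁ (dB x) + m₁ * n₂                              ≡⟨ cong (_+ m₁ * n₂) (sumFin-cong n₁ colB) ⟨
      sumFin n₁ (λ b → count (λ a → AB G a b) + count (λ c → CB G c b)) + m₁ * n₂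
                                                              ≡⟨ cong (_+ m₁ * n₂) (sumFin-+ n₁ _ _) ⟩
      sumFin n₁ (λ b → count (λ a → AB G a b)) + U + m₁ * n₂  ≡⟨ cong (λ s → s + U + m₁ * n₂) (sumFin-comm m₁ n₁ _) ⟨
      S + U + m₁ * n₂                                         ≡⟨ +-assoc S U _ ⟩
      S + (U + m₁ * n₂)                                       ∎)
      where open ≡-Reasoning

    U≡0 : U ≡ 0
    U≡0 = n≤0⇒n≡0 (+-cancelʳ-≤ (m₁ * n₂) U 0 (begin
      U + m₁ * n₂                ≡⟨ T≡U+m₁n₂ ⟨
      T                          ≤⟨ sumFin-mono m₁ (count≤ ∘ AD G) ⟩
      sumFin m₁ (λ _ → n₂)       ≡⟨ sumFin-const m₁ n₂ ⟩
      m₁ * n₂                    ∎))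
      where open ≤-Reasoning

    count-AD-row : ∀ a → count (AD G a) ≡ n₂
    count-AD-row = sumFin-≡-≤⇒≗ m₁ (count≤ ∘ AD G)
      (trans T≡U+m₁n₂ (trans (cong (_+ m₁ * n₂) U≡0) (sym (sumFin-const m₁ n₂))))

    count-CB-col : ∀ b → count (λ c → CB G c b) ≡ 0
    count-CB-col = sumFin≡0⇒≗0 n₁ U≡0

    AD-full : ∀ a d → AD G a d ≡ true
    AD-full a = count≡k⇒true (AD G a) (count-AD-row a)

    CB-empty : ∀ c b → CB G c b ≡ false
    CB-empty c b = count≡0⇒false _ (count-CB-col b) c

    ≡∘-graph-restriction : G ≡ ∘-graph x y (restriction G)
    ≡∘-graph-restriction = ≡-byBlocks
      (λ a b → sym (trans (AB-block _ _ _ _ a b) (entry-graph (AB G) a b)))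
      (λ a d → trans (AD-full a d) (sym (AD-block _ _ _ _ a d)))
      (λ c b → trans (CB-empty c b) (sym (CB-block _ _ _ _ c b)))
      (λ c d → sym (trans (CD-block _ _ _ _ c d) (entry-graph (CD G) c d)))

    restriction-realizes : Realizes x (proj₁ (restriction G)) × Realizes y (proj₂ (restriction G))
    restriction-realizes =
      ( (λ a → trans (count-cong (entry-graph (AB G) a))
          (+-cancelʳ-≡ n₂ _ _ (trans (cong (count (AB G a) +_) (sym (count-AD-row a))) (rowA a))))
      , (λ b → trans (count-cong (λ a → entry-graph (AB G) a b))
          (trans (sym (+-identityʳ _)) (trans (cong (count (λ a → AB G a b) +_) (sym (count-CB-col b))) (colB b)))) )
      , ( (λ c → trans (count-cong (entry-graph (CD G) c))
          (trans (cong (_+ count (CD G c)) (sym count-CB-row)) (rowC c)))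
      , (λ d → trans (count-cong (λ c → entry-graph (CD G) c d))
          (+-cancelˡ-≡ m₁ _ _ (trans (cong (_+ count (λ c → CD G c d)) (sym count-AD-col))
            (trans (colD d) (+-comm _ m₁))))) )
      where
      count-CB-row : ∀ {c} → count (CB G c) ≡ 0
      count-CB-row {c} = trans (count-cong (CB-empty c)) (count-false n₁)
      count-AD-col : ∀ {d} → count (λ a → AD G a d) ≡ m₁
      count-AD-col {d} = trans (count-cong (λ a → AD-full a d)) (count-true m₁)

  restriction-injective : Balanced x → ∀ {G G′} → Realizes (x ∘ᵇ y) G → Realizes (x ∘ᵇ y) G′ →
    restriction G ≡ restriction G′ → G ≡ G′
  restriction-injective x-balanced {G} {G′} G⊨ G′⊨ same = begin
    G                              ≡⟨ Forced.≡∘-graph-restriction x-balanced G G⊨ ⟩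
    ∘-graph x y (restriction G)    ≡⟨ cong (∘-graph x y) same ⟩
    ∘-graph x y (restriction G′)   ≡⟨ Forced.≡∘-graph-restriction x-balanced G′ G′⊨ ⟨
    G′                             ∎
    where open ≡-Reasoning

  numReal-∘-≤ : Balanced x → numReal (x ∘ᵇ y) ≤ numReal x * numReal y
  numReal-∘-≤ x-balanced = begin
    numReal (x ∘ᵇ y)
      ≤⟨ injection⇒length≤ restriction (realizations-unique (x ∘ᵇ y)) restriction∈
           (λ G∈ G′∈ → restriction-injective x-balanced (∈-realizations⁻ _ G∈) (∈-realizations⁻ _ G′∈)) ⟩
    length (cartesianProduct (realizations x) (realizations y))
      ≡⟨ length-cartesianProduct (realizations x) (realizations y) ⟩
    numReal x * numReal y ∎
    where
    open ≤-Reasoning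
    restriction∈ : ∀ {G} → G ∈ realizations (x ∘ᵇ y) →
      restriction G ∈ cartesianProduct (realizations x) (realizations y)
    restriction∈ {G} G∈ =
      let Gx⊨ , Gy⊨ = Forced.restriction-realizes x-balanced G (∈-realizations⁻ (x ∘ᵇ y) G∈) in
      ∈-cartesianProduct⁺ (∈-realizations⁺ x Gx⊨) (∈-realizations⁺ y Gy⊨)

∣m∸n-m∣≤n : ∀ m n → ∣ m ∸ n - m ∣ ≤ n
∣m∸n-m∣≤n m n with ≤-total n m
... | inj₁ n≤m = ≤-reflexive (trans (m≤n⇒∣m-n∣≡n∸m (m∸n≤m m n)) (m∸[m∸n]≡n n≤m))
... | inj₂ m≤n rewrite m≤n⇒m∸n≡0 m≤n = ≤-trans (≤-reflexive (∣-∣-identityˡ m)) m≤n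

-- Truncated subtraction: a vertex of degree 0 keeps degree 0, which is why the lower bound
-- below assumes the marked vertices have positive degree.
decAt : ∀ {k} → Fin k → (Fin k → ℕ) → Fin k → ℕ
decAt i f j = f j ∸ b2n (δ i j)

decrease : (z : BSeq) → Fin (m z) → Fin (n z) → BSeq
decrease z a d = bseq (m z) (n z) (decAt a (dA z)) (decAt d (dB z))

dist₁-decrease : ∀ z a d → dist₁ z (decAt a (dA z)) (decAt d (dB z)) ≤ 2
dist₁-decrease z a d = +-mono-≤ (dist-decAt a (dA z)) (dist-decAt d (dB z))
  where
  dist-decAt : ∀ {k} (i : Fin k) f → sumFin k (λ j → ∣ decAt i f j - f j ∣) ≤ 1
  dist-decAt {k} i f =
    ≤-trans (sumFin-mono k (λ j → ∣m∸n-m∣≤n (f j) (b2n (δ i j)))) (≤-reflexive (count-δ i))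

module _ (x y : BSeq) (a : Fin (m x)) (b : Fin (n x)) (c : Fin (m y)) (d : Fin (n y)) where
  open Blocks (m x) (m y) (n x) (n y)
  private
    m₁ = m x
    m₂ = m y
    n₁ = n x
    n₂ = n y
    target = decrease (x ∘ᵇ y) (a ↑ˡ m₂) (n₁ ↑ʳ d)

    dA-target-↑ˡ : ∀ a′ → dA target (a′ ↑ˡ m₂) ≡ dA x a′ + n₂ ∸ b2n (δ a a′)
    dA-target-↑ˡ a′ = cong₂ _∸_ (dA-∘-↑ˡ x y a′) (cong b2n (δ-injective (↑ˡ-injective m₂ _ _) a a′))
    dA-target-↑ʳ : ∀ c′ → dA target (m₁ ↑ʳ c′) ≡ dA y c′
    dA-target-↑ʳ c′ = cong₂ _∸_ (dA-∘-↑ʳ x y c′) (cong b2n (δ-≢ (↑ˡ≢↑ʳ a c′)))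
    dB-target-↑ˡ : ∀ b′ → dB target (b′ ↑ˡ n₂) ≡ dB x b′
    dB-target-↑ˡ b′ = cong₂ _∸_ (dB-∘-↑ˡ x y b′) (cong b2n (δ-≢ (↑ˡ≢↑ʳ b′ d ∘ sym)))
    dB-target-↑ʳ : ∀ d′ → dB target (n₁ ↑ʳ d′) ≡ dB y d′ + m₁ ∸ b2n (δ d d′)
    dB-target-↑ʳ d′ = cong₂ _∸_ (dB-∘-↑ʳ x y d′) (cong b2n (δ-injective (↑ʳ-injective n₁ _ _) d d′))

  omitEdge : Graph m₁ n₁ × Graph m₂ n₂ → Graph (m₁ + m₂) (n₁ + n₂)
  omitEdge = assemble (λ a′ d′ → not (point a d a′ d′)) (λ _ _ → false)

  omitEdge-realizes : ∀ Gx Gy → Realizes x Gx → Realizes y Gy → Realizes target (omitEdge (Gx , Gy))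
  omitEdge-realizes Gx Gy (Gx⊨A , Gx⊨B) (Gy⊨A , Gy⊨B) =
    block-realizes (entry Gx) (λ a′ d′ → not (point a d a′ d′)) (λ _ _ → false) (entry Gy) (dA target) (dB target)
      (λ a′ → begin
        degA Gx a′ + count (not ∘ point a d a′)            ≡⟨ cong₂ _+_ (Gx⊨A a′) (count-not (point a d a′)) ⟩
        dA x a′ + (n₂ ∸ count (point a d a′))              ≡⟨ +-∸-assoc (dA x a′) (count≤ (point a d a′)) ⟨
        dA x a′ + n₂ ∸ count (point a d a′)                ≡⟨ cong (dA x a′ + n₂ ∸_) (count-point-row a d a′) ⟩
        dA x a′ + n₂ ∸ b2n (δ a a′)                        ≡⟨ dA-target-↑ˡ a′ ⟨
        dA target (a′ ↑ˡ m₂)                               ∎)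
      (λ c′ → trans (cong₂ _+_ (count-false n₁) (Gy⊨A c′)) (sym (dA-target-↑ʳ c′)))
      (λ b′ → trans (cong₂ _+_ (Gx⊨B b′) (count-false m₂)) (trans (+-identityʳ _) (sym (dB-target-↑ˡ b′))))
      (λ d′ → begin
        count (λ a′ → not (point a d a′ d′)) + degB Gy d′  ≡⟨ cong₂ _+_ (count-not (λ a′ → point a d a′ d′)) (Gy⊨B d′) ⟩
        (m₁ ∸ count (λ a′ → point a d a′ d′)) + dB y d′   ≡⟨ +-comm _ (dB y d′) ⟩
        dB y d′ + (m₁ ∸ count (λ a′ → point a d a′ d′))   ≡⟨ +-∸-assoc (dB y d′) (count≤ (λ a′ → point a d a′ d′)) ⟨
        dB y d′ + m₁ ∸ count (λ a′ → point a d a′ d′)     ≡⟨ cong (dB y d′ + m₁ ∸_) (count-point-col a d d′) ⟩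
        dB y d′ + m₁ ∸ b2n (δ d d′)                       ≡⟨ dB-target-↑ʳ d′ ⟨
        dB target (n₁ ↑ʳ d′)                              ∎)
    where open ≡-Reasoning

  addEdge : Graph m₁ n₁ × Graph m₂ n₂ → Graph (m₁ + m₂) (n₁ + n₂)
  addEdge = assemble (λ _ _ → true) (point c b)

  module _ (a-pos : 1 ≤ dA x a) (b-pos : 1 ≤ dB x b) (c-pos : 1 ≤ dA y c) (d-pos : 1 ≤ dB y d) where

    addEdge-realizes : ∀ Gx Gy → Realizes (decrease x a b) Gx → Realizes (decrease y c d) Gy →
      Realizes target (addEdge (Gx , Gy))
    addEdge-realizes Gx Gy (Gx⊨A , Gx⊨B) (Gy⊨A , Gy⊨B) =
      block-realizes (entry Gx) (λ _ _ → true) (point c b) (entry Gy) (dA target) (dB target)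
        (λ a′ → begin
          degA Gx a′ + count {n₂} (λ _ → true)       ≡⟨ cong₂ _+_ (Gx⊨A a′) (count-true n₂) ⟩
          decAt a (dA x) a′ + n₂                      ≡⟨ +-∸-comm n₂ (δ≤ (dA x) a a-pos a′) ⟨
          dA x a′ + n₂ ∸ b2n (δ a a′)                 ≡⟨ dA-target-↑ˡ a′ ⟨
          dA target (a′ ↑ˡ m₂)                        ∎)
        (λ c′ → begin
          count (point c b c′) + degA Gy c′           ≡⟨ cong₂ _+_ (count-point-row c b c′) (Gy⊨A c′) ⟩
          b2n (δ c c′) + decAt c (dA y) c′            ≡⟨ m+[n∸m]≡n (δ≤ (dA y) c c-pos c′) ⟩
          dA y c′                                     ≡⟨ dA-target-↑ʳ c′ ⟨
          dA target (m₁ ↑ʳ c′)                        ∎)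
        (λ b′ → begin
          degB Gx b′ + count (λ c′ → point c b c′ b′) ≡⟨ cong₂ _+_ (Gx⊨B b′) (count-point-col c b b′) ⟩
          decAt b (dB x) b′ + b2n (δ b b′)            ≡⟨ m∸n+n≡m (δ≤ (dB x) b b-pos b′) ⟩
          dB x b′                                     ≡⟨ dB-target-↑ˡ b′ ⟨
          dB target (b′ ↑ˡ n₂)                        ∎)
        (λ d′ → begin
          count {m₁} (λ _ → true) + degB Gy d′        ≡⟨ cong₂ _+_ (count-true m₁) (Gy⊨B d′) ⟩
          m₁ + decAt d (dB y) d′                      ≡⟨ +-comm m₁ _ ⟩
          decAt d (dB y) d′ + m₁                      ≡⟨ +-∸-comm m₁ (δ≤ (dB y) d d-pos d′) ⟨
          dB y d′ + m₁ ∸ b2n (δ d d′)                 ≡⟨ dB-target-↑ʳ d′ ⟨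
          dB target (n₁ ↑ʳ d′)                        ∎)
      where open ≡-Reasoning

    numReal-decrease-∘-≥ :
      numReal x * numReal y + numReal (decrease x a b) * numReal (decrease y c d)
        ≤ numReal (decrease (x ∘ᵇ y) (a ↑ˡ m y) (n x ↑ʳ d))
    numReal-decrease-∘-≥ = begin
      numReal x * numReal y + numReal (decrease x a b) * numReal (decrease y c d)
        ≡⟨ length-families ⟨
      length families
        ≤⟨ unique⊆⇒length≤ families-unique families⊆realizations ⟩
      numReal target ∎
      where
      open ≤-Reasoning
      P₁ = cartesianProduct (realizations x) (realizations y)
      P₂ = cartesianProduct (realizations (decrease x a b)) (realizations (decrease y c d))
      families = map omitEdge P₁ ++ map addEdge P₂

      length-families :
        length families ≡ numReal x * numReal y + numReal (decrease x a b) * numReal (decrease y c d)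
      length-families = trans (length-++ (map omitEdge P₁)) (cong₂ _+_ (length-map-pairs omitEdge) (length-map-pairs addEdge))

      omitEdge≢addEdge : ∀ p q → omitEdge p ≢ addEdge q
      omitEdge≢addEdge p q same with
        trans (sym (CB-block _ _ _ _ c b)) (trans (cong (λ G → CB G c b) same)
          (trans (CB-block _ _ _ _ c b) (cong₂ _∧_ (δ-refl c) (δ-refl b))))
      ... | ()

      families-unique : Unique families
      families-unique = Unique.++⁺
        (map-pairs-unique omitEdge (assemble-injective _ _))
        (map-pairs-unique addEdge (assemble-injective _ _))
        disjoint
        where
        disjoint : Disjoint (map omitEdge P₁) (map addEdge P₂)
        disjoint (G∈₁ , G∈₂) with ∈-map⁻ omitEdge G∈₁ | ∈-map⁻ addEdge G∈₂
        ... | p , _ , refl | q , _ , same = omitEdge≢addEdge p q same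

      families⊆realizations : ∀ {G} → G ∈ families → G ∈ realizations target
      families⊆realizations G∈ with ∈-++⁻ (map omitEdge P₁) G∈
      ... | inj₁ G∈₁ = pairs⊆realizations omitEdge omitEdge-realizes G∈₁
      ... | inj₂ G∈₂ = pairs⊆realizations addEdge addEdge-realizes G∈₂

n<2^n : ∀ n → n < 2 ^ n
n<2^n zero    = z<s
n<2^n (suc n) = +-mono-≤ (m^n>0 2 n) (≤-trans (n<2^n n) (m≤m+n (2 ^ n) 0))

evalP-double : ∀ p x → evalP p (x + x) ≤ 2 ^ length p * evalP p x
evalP-double []       x = z≤n
evalP-double (c ∷ cs) x = begin
  c + (x + x) * evalP cs (x + x)           ≤⟨ +-monoʳ-≤ c (*-monoʳ-≤ (x + x) (evalP-double cs x)) ⟩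
  c + (x + x) * (q * evalP cs x)           ≤⟨ +-monoˡ-≤ _ (m≤n*m c (2 ^ suc (length cs)) {{m^n≢0 2 (suc (length cs))}}) ⟩
  2 * q * c + (x + x) * (q * evalP cs x)   ≡⟨ regroup c x q (evalP cs x) ⟩
  2 * q * (c + x * evalP cs x)             ∎
  where
  open ≤-Reasoning
  q = 2 ^ length cs
  regroup : ∀ c x q e → 2 * q * c + (x + x) * (q * e) ≡ 2 * q * (c + x * e)
  regroup = solve-∀

outgrows-geometric : ∀ (f g : ℕ → ℕ) c .{{_ : NonZero c}} → 0 < f 0 →
  (∀ k → 2 * c * f k ≤ f (suc k)) → (∀ k → g (suc k) ≤ c * g k) → ¬ (∀ k → f k ≤ g k)
outgrows-geometric f g c f₀>0 f-grows g-grows f≤g = <-irrefl refl (begin-strict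
  f j * g 0              <⟨ *-monoʳ-< (f j) {{>-nonZero (f>0 j)}} (n<2^n (g 0)) ⟩
  f j * 2 ^ j            ≤⟨ m≤m*n (f j * 2 ^ j) (f 0) {{>-nonZero f₀>0}} ⟩
  f j * 2 ^ j * f 0      ≤⟨ *-monoˡ-≤ (f 0) (*-monoˡ-≤ (2 ^ j) (f≤g j)) ⟩
  g j * 2 ^ j * f 0      ≤⟨ ratio-invariant j ⟩
  f j * g 0              ∎)
  where
  open ≤-Reasoning
  j = g 0
  f>0 : ∀ k → 0 < f k
  f>0 zero    = f₀>0
  f>0 (suc k) = ≤-trans (f>0 k) (≤-trans (m≤n*m (f k) (2 * c) {{m*n≢0 2 c}}) (f-grows k))
  ratio-invariant : ∀ k → g k * 2 ^ k * f 0 ≤ f k * g 0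
  ratio-invariant zero    = ≤-reflexive (regroup (g 0) (f 0))
    where
    regroup : ∀ g₀ f₀ → g₀ * 1 * f₀ ≡ f₀ * g₀
    regroup = solve-∀
  ratio-invariant (suc k) = begin
    g (suc k) * 2 ^ suc k * f 0   ≤⟨ *-monoˡ-≤ (f 0) (*-monoˡ-≤ (2 ^ suc k) (g-grows k)) ⟩
    c * g k * 2 ^ suc k * f 0     ≡⟨ regroup c (g k) (2 ^ k) (f 0) ⟩
    2 * c * (g k * 2 ^ k * f 0)   ≤⟨ *-monoʳ-≤ (2 * c) (ratio-invariant k) ⟩
    2 * c * (f k * g 0)           ≡⟨ *-assoc (2 * c) (f k) (g 0) ⟨
    2 * c * f k * g 0             ≤⟨ *-monoˡ-≤ (g 0) (f-grows k) ⟩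
    f (suc k) * g 0               ∎
    where
    regroup : ∀ c g p f → c * g * (2 * p) * f ≡ 2 * c * (g * p * f)
    regroup = solve-∀

ratio : ℕ → ℕ
ratio zero    = 0
ratio (suc k) = suc (ratio k * ratio k)

ratio≤ratio² : ∀ k → ratio k ≤ ratio k * ratio k
ratio≤ratio² zero    = z≤n
ratio≤ratio² (suc k) = m≤m*n (ratio (suc k)) (ratio (suc k))

n≤ratio : ∀ k → k ≤ ratio k
n≤ratio zero    = z≤n
n≤ratio (suc k) = s≤s (≤-trans (n≤ratio k) (ratio≤ratio² k))

ratio-outgrows-geometric : ∀ (g : ℕ → ℕ) c → (∀ k → g (suc k) ≤ c * g k) → ¬ (∀ k → ratio k ≤ g k)
ratio-outgrows-geometric g c g-grows ratio≤g =
  outgrows-geometric (ratio ∘ (k₀ +_)) (g ∘ (k₀ +_)) (suc c) (≤-trans z<s (k₀≤ratio 0)) ratio-grows g-grows′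
    (ratio≤g ∘ (k₀ +_))
  where
  k₀ = 2 * suc c
  k₀≤ratio : ∀ j → k₀ ≤ ratio (k₀ + j)
  k₀≤ratio j = ≤-trans (m≤m+n k₀ j) (n≤ratio (k₀ + j))
  ratio-grows : ∀ j → k₀ * ratio (k₀ + j) ≤ ratio (k₀ + suc j)
  ratio-grows j = begin
    k₀ * ratio (k₀ + j)               ≤⟨ *-monoˡ-≤ (ratio (k₀ + j)) (k₀≤ratio j) ⟩
    ratio (k₀ + j) * ratio (k₀ + j)   <⟨ n<1+n _ ⟩
    ratio (suc (k₀ + j))              ≡⟨ cong ratio (+-suc k₀ j) ⟨
    ratio (k₀ + suc j)                ∎
    where open ≤-Reasoning
  g-grows′ : ∀ j → g (k₀ + suc j) ≤ suc c * g (k₀ + j)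
  g-grows′ j = begin
    g (k₀ + suc j)      ≡⟨ cong g (+-suc k₀ j) ⟩
    g (suc (k₀ + j))    ≤⟨ g-grows (k₀ + j) ⟩
    c * g (k₀ + j)      ≤⟨ *-monoˡ-≤ (g (k₀ + j)) (n≤1+n c) ⟩
    suc c * g (k₀ + j)  ∎
    where open ≤-Reasoning

record Marked : Set where
  field
    seq   : BSeq
    a     : Fin (m seq)
    d     : Fin (n seq)
    a-pos : 1 ≤ dA seq a
    d-pos : 1 ≤ dB seq d

open Marked

decreased : Marked → BSeq
decreased s = decrease (seq s) (a s) (d s)

markedComposition : ∀ x y → Fin (m x) → Fin (n y) → Marked
markedComposition x y a d = record
  { seq   = x ∘ᵇ y
  ; a     = a ↑ˡ m y
  ; d     = n x ↑ʳ d
  ; a-pos = ≤-trans (>-nonZero⁻¹ (n y) {{nonZeroIndex d}})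
              (≤-trans (m≤n+m (n y) (dA x a)) (≤-reflexive (sym (dA-∘-↑ˡ x y a))))
  ; d-pos = ≤-trans (>-nonZero⁻¹ (m x) {{nonZeroIndex a}})
              (≤-trans (m≤n+m (m x) (dB y d)) (≤-reflexive (sym (dB-∘-↑ʳ x y d))))
  }

module Doubling (α β : BSeq) (a₀ : Fin (m α)) (d₀ : Fin (n β)) where

  stage : ℕ → Marked
  stage zero    = markedComposition α β a₀ d₀
  stage (suc k) = markedComposition (seq (stage k)) (seq (stage k)) (a (stage k)) (d (stage k))

  stage-closure : ∀ {𝒟 : BSeq → Set} → 𝒟 α → 𝒟 β → ∀ k → Closure 𝒟 (seq (stage k))
  stage-closure α∈𝒟 β∈𝒟 zero    = comp (base α∈𝒟) (base β∈𝒟)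
  stage-closure α∈𝒟 β∈𝒟 (suc k) = comp (stage-closure α∈𝒟 β∈𝒟 k) (stage-closure α∈𝒟 β∈𝒟 k)

  size-stage : ∀ k → size (seq (stage (suc k))) ≡ size (seq (stage k)) + size (seq (stage k))
  size-stage k = regroup (m (seq (stage k))) (n (seq (stage k)))
    where
    regroup : ∀ a b → (a + a) + (b + b) ≡ (a + b) + (a + b)
    regroup = solve-∀

  ratio-bound : IsBDS α → IsBDS β → ∀ k → ratio k * numReal (seq (stage k)) ≤ numReal (decreased (stage k))
  ratio-bound α-BDS β-BDS zero    = z≤n
  ratio-bound α-BDS β-BDS (suc k) = begin
    suc (t * t) * numReal (Z ∘ᵇ Z)    ≤⟨ *-monoʳ-≤ (suc (t * t)) (numReal-∘-≤ Z Z Z-balanced) ⟩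
    suc (t * t) * (r * r)             ≡⟨ expand t r ⟩
    r * r + (t * r) * (t * r)         ≤⟨ +-monoʳ-≤ (r * r) (*-mono-≤ ih ih) ⟩
    r * r + R * R                     ≤⟨ numReal-decrease-∘-≥ Z Z (a s) (d s) (a s) (d s)
                                           (a-pos s) (d-pos s) (a-pos s) (d-pos s) ⟩
    numReal (decreased (stage (suc k))) ∎
    where
    open ≤-Reasoning
    s = stage k
    Z = seq s
    t = ratio k
    r = numReal Z
    R = numReal (decreased s)
    ih = ratio-bound α-BDS β-BDS k
    Z-balanced = IsBDS⇒Balanced Z (IsBDS-closure (λ _ z-BDS → z-BDS) (stage-closure α-BDS β-BDS k))
    expand : ∀ t r → suc (t * t) * (r * r) ≡ r * r + (t * r) * (t * r)
    expand = solve-∀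

mainTheorem3 : (𝒟 : BSeq → Set) → (∀ d → 𝒟 d → IsBDS d) →
    (α : BSeq) → 𝒟 α → m α ≥ 1 →
    (β : BSeq) → 𝒟 β → n β ≥ 1 →
    ¬ PStable (Closure 𝒟)
mainTheorem3 𝒟 𝒟⊆BDS α α∈𝒟 m≥1 β β∈𝒟 n≥1 (p , stable) =
  ratio-outgrows-geometric P (2 ^ length p) P-doubles ratio≤P
  where
  open Doubling α β (fromℕ< m≥1) (fromℕ< n≥1)
  P : ℕ → ℕ
  P k = evalP p (size (seq (stage k)))
  P-doubles : ∀ k → P (suc k) ≤ 2 ^ length p * P k
  P-doubles k = ≤-trans (≤-reflexive (cong (evalP p) (size-stage k))) (evalP-double p _)
  ratio≤P : ∀ k → ratio k ≤ P k
  ratio≤P k = *-cancelʳ-≤ (ratio k) (P k) (numReal z) {{>-nonZero (numReal-pos z z-BDS)}}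
    (≤-trans (ratio-bound (𝒟⊆BDS α α∈𝒟) (𝒟⊆BDS β β∈𝒟) k)
      (stable z z∈closure _ _ (dist₁-decrease z (a (stage k)) (d (stage k)))))
    where
    z = seq (stage k)
    z∈closure = stage-closure α∈𝒟 β∈𝒟 k
    z-BDS = IsBDS-closure 𝒟⊆BDS z∈closure
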